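{- For every $m\ge 2$, let $P_m$ be the polygon graph with vertices $u_1,\dots,u_m$ in cyclic order, all distinguished in this order. Then its state sum decomposition is \[ v_{P_m}=\mathscr{F}_m+n\otimes\mathscr{F}_{m-2}\otimes n, \] where for $m=2$ the second term is read as $n\otimes n$.
   Context: The polygon graph $P_m$ is the cycle $u_1u_2\cdots u_mu_1$ for $m\ge 3$, and $P_2$ consists of two vertices joined by two parallel edges. State sum decomposition: let $G$ be a finite graph with an ordered list of distinguished vertices $x_1,\dots,x_k$. For $\epsilon=(\epsilon_1,\dots,\epsilon_k)\in\{y,n\}^k$, let $G(\epsilon)$ be the number of perfect matchings of the graph obtained from $G$ by deleting every $x_i$ with $\epsilon_i=y$ (the empty graph has one perfect matching). Then $v_G=\sum_{\epsilon} G(\epsilon)\,\epsilon_1\otimes\cdots\otimes\epsilon_k$, a formal $\mathbb{Z}$-linear combination of words in $y,n$ (viewed inside $\mathcal{M}^{\otimes k}$ for the matching algebra $\mathcal{M}=\mathbb{Z}\langle y,n\rangle/\langle yn=ny=n,\ n^2=0,\ y^2=y\rangle$). A word $\epsilon_1\otimes\cdots\otimes\epsilon_k$ is a Fibonacci tensor if the positions $i$ with $\epsilon_i=n$ can be partitioned into pairs of the form $\{i,i+1\}$; $\mathscr{F}_k$ is the sum of all Fibonacci tensors of length $k$, and $n\otimes\mathscr{F}_{m-2}\otimes n$ denotes the sum of the words $n\otimes w\otimes n$ over all Fibonacci tensors $w$ of length $m-2$. -}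

module Defs where

open import Data.Nat using (ℕ; zero; suc; _+_; _<_; _≟_; NonZero)
open import Data.Nat.Properties using (_<?_)
open import Data.Nat.DivMod using (_%_; m%n<n)
open import Data.Bool using (Bool; true; false; _∧_; _∨_; if_then_else_)
import Data.Bool.Properties as BoolP
open import Data.Fin using (Fin; toℕ; fromℕ<)
import Data.Fin as Fin
open import Data.Fin.Properties using (all?)
open import Data.Vec using (Vec; []; _∷_; lookup; init; last)
open import Data.List using (List; length; filter; map; allFin)
open import Data.Nat.ListAction using (sum)
open import Data.Product using (Σ; _×_; _,_; proj₁; proj₂)
open import Data.Sum using (inj₁; inj₂)
open import Relation.Binary.PropositionalEquality using (_≡_; refl)
open import Relation.Nullary using (Dec; yes; no; ¬_)
open import Relation.Nullary.Decidable using (⌊_⌋; _×-dec_; _→-dec_)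

-- Letters y, n and words (pure tensors  ε₁ ⊗ ⋯ ⊗ εₖ)

data Letter : Set where
  y n : Letter

_≟L_ : (a b : Letter) → Dec (a ≡ b)
y ≟L y = yes refl
y ≟L n = no λ ()
n ≟L y = no λ ()
n ≟L n = yes refl

Word : ℕ → Set
Word k = Vec Letter k

-- A formal ℕ-linear combination of words of length k (its coefficient
-- function; all coefficients occurring here are non-negative).
Comb : ℕ → Set
Comb k = Word k → ℕ

dec∃Vec : (k : ℕ) (P : Vec Bool k → Set) → ((S : Vec Bool k) → Dec (P S)) →
          Dec (Σ (Vec Bool k) P)
dec∃Vec zero P P? with P? []
... | yes p = yes ([] , p)
... | no ¬p = no λ { ([] , p) → ¬p p }
dec∃Vec (suc k) P P? with dec∃Vec k (λ S → P (true ∷ S)) (λ S → P? (true ∷ S))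
... | yes (S , p) = yes (true ∷ S , p)
... | no ¬t with dec∃Vec k (λ S → P (false ∷ S)) (λ S → P? (false ∷ S))
...   | yes (S , p) = yes (false ∷ S , p)
...   | no ¬f = no λ { (true ∷ S , p) → ¬t (S , p) ; (false ∷ S , p) → ¬f (S , p) }

-- all subsets of an index set Fin k, as characteristic vectors (each once)
subsets : (k : ℕ) → List (Vec Bool k)
subsets zero = [] ∷ []
  where open Data.List using (_∷_; [])
subsets (suc k) = map (true ∷_) (subsets k) Data.List.++ map (false ∷_) (subsets k)
  where import Data.List

-- Finite multigraphs (parallel edges allowed)

record Multigraph : Set where
  field
    V    : ℕ
    E    : ℕ
    ends : Fin E → Fin V × Fin V
open Multigraph public

χ : Bool → ℕ
χ b = if b then 1 else 0

incident : (G : Multigraph) → Fin (E G) → Fin (V G) → Bool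
incident G e v = ⌊ proj₁ (ends G e) Fin.≟ v ⌋ ∨ ⌊ proj₂ (ends G e) Fin.≟ v ⌋

degree : (G : Multigraph) → Vec Bool (E G) → Fin (V G) → ℕ
degree G M v = sum (map (λ e → χ (lookup M e ∧ incident G e v)) (allFin (E G)))

-- M (a set of edges) is a perfect matching of the graph obtained from G
-- by deleting the vertices v with  del v ≡ true :
-- every edge of M joins two non-deleted vertices, and every non-deleted
-- vertex lies on exactly one edge of M.
IsPerfectMatching : (G : Multigraph) → (Fin (V G) → Bool) → Vec Bool (E G) → Set
IsPerfectMatching G del M =
  ((e : Fin (E G)) → lookup M e ≡ true →
      (del (proj₁ (ends G e)) ≡ false) × (del (proj₂ (ends G e)) ≡ false))
  × ((v : Fin (V G)) → del v ≡ false → degree G M v ≡ 1)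

isPerfectMatching? : (G : Multigraph) (del : Fin (V G) → Bool) (M : Vec Bool (E G)) →
                     Dec (IsPerfectMatching G del M)
isPerfectMatching? G del M =
  all? (λ e → (lookup M e BoolP.≟ true) →-dec
              ((del (proj₁ (ends G e)) BoolP.≟ false) ×-dec (del (proj₂ (ends G e)) BoolP.≟ false)))
  ×-dec
  all? (λ v → (del v BoolP.≟ false) →-dec (degree G M v ≟ 1))

-- number of perfect matchings of G minus the deleted vertices
-- (the empty graph has exactly one, the empty matching)
numPerfectMatchings : (G : Multigraph) → (Fin (V G) → Bool) → ℕ
numPerfectMatchings G del = length (filter (isPerfectMatching? G del) (subsets (E G)))

deletedIn : (G : Multigraph) {k : ℕ} → Vec (Fin (V G)) k → Word k → Fin (V G) → Bool
deletedIn G [] [] v = false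
deletedIn G (x ∷ xs) (e ∷ es) v =
  (⌊ x Fin.≟ v ⌋ ∧ ⌊ e ≟L y ⌋) ∨ deletedIn G xs es v

-- v_G = Σ_ε G(ε) ε₁ ⊗ ⋯ ⊗ εₖ  (coefficient of the word ε is G(ε))
stateSum : (G : Multigraph) {k : ℕ} → Vec (Fin (V G)) k → Comb k
stateSum G xs ε = numPerfectMatchings G (deletedIn G xs ε)

-- Polygon graphs: vertices u₁,…,u_m = Fin m, edge i joins uᵢ and u_{i+1 mod m}.
-- For m ≥ 3 this is the cycle; for m = 2 it gives two parallel edges
-- joining u₁ and u₂, i.e. P₂.

polygon : (m : ℕ) → .{{NonZero m}} → Multigraph
polygon m = record
  { V = m
  ; E = m
  ; ends = λ i → i , fromℕ< (m%n<n (suc (toℕ i)) m)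
  }

polygonVertices : (m : ℕ) → Vec (Fin m) m
polygonVertices m = Data.Vec.allFin m
  where import Data.Vec

-- S ⊆ Fin k is a set of pair starts p (pairs {p, p+1}) that partitions the
-- n-positions of w: every pair lies inside {0,…,k-1}, and each position i is
-- covered by exactly one pair if wᵢ = n and by none if wᵢ = y.
covers : {k : ℕ} → Vec Bool k → Fin k → ℕ
covers {k} S i =
  sum (map (λ p → χ (lookup S p ∧ (⌊ toℕ p ≟ toℕ i ⌋ ∨ ⌊ suc (toℕ p) ≟ toℕ i ⌋))) (allFin k))

isN : Letter → ℕ
isN y = 0
isN n = 1

PairPartition : {k : ℕ} → Word k → Vec Bool k → Set
PairPartition {k} w S =
  ((p : Fin k) → lookup S p ≡ true → suc (toℕ p) < k)
  × ((i : Fin k) → covers S i ≡ isN (lookup w i))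

IsFibonacci : {k : ℕ} → Word k → Set
IsFibonacci {k} w = Σ (Vec Bool k) (PairPartition w)

isFibonacci? : {k : ℕ} (w : Word k) → Dec (IsFibonacci w)
isFibonacci? {k} w = dec∃Vec k (PairPartition w) λ S →
  all? (λ p → (lookup S p BoolP.≟ true) →-dec (suc (toℕ p) <? k))
  ×-dec all? (λ i → covers S i ≟ isN (lookup w i))

fibSum : (k : ℕ) → Comb k
fibSum k w = χ ⌊ isFibonacci? w ⌋

n⊗_⊗n : {k : ℕ} → Comb k → Comb (suc (suc k))
(n⊗ f ⊗n) (a ∷ w) = isN a * (isN (last w) * f (init w))
  where open Data.Nat using (_*_)

_⊕_ : {k : ℕ} → Comb k → Comb k → Comb k
(f ⊕ g) w = f w + g w

{-# OPTIONS --safe #-}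
-- An edge set M of P_m (edge i joins u_i and u_{i+1 mod m}) is a perfect
-- matching of P_m minus the y-vertices of ε iff each vertex v lies on exactly
-- [ε_v = n] of its two edges M_{v-1}, M_v.  Cutting the cycle at the last edge
-- makes this a domino tiling of the word ε whose incoming and outgoing
-- dominoes agree, and a tiling is determined by ε and its incoming domino, so
-- each value of that bit contributes 0 or 1.  Without a domino across the cut
-- the tilings are exactly the pair partitions of ε, giving 𝓕_m; with one, ε
-- must start and end with n and the rest is a pair partition of the middle
-- word, giving n ⊗ 𝓕_{m-2} ⊗ n.
module Submission where

open import Defs
open import Data.Bool using (Bool; true; false; _∧_; _∨_; T)
open import Data.Bool.Properties using (∧-identityʳ; ∧-zeroʳ; ∨-zeroʳ)
import Data.Bool.Properties as Bool
open import Data.Empty using (⊥; ⊥-elim)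
open import Data.Fin using (Fin; zero; suc; toℕ; fromℕ; inject₁)
open import Data.Fin.Properties using (toℕ-injective; toℕ-fromℕ<; toℕ-fromℕ; toℕ-inject₁; toℕ<n)
import Data.Fin.Properties as Fin
open import Data.Fin.Relation.Unary.Top using (view; ‵fromℕ; ‵inject₁)
open import Data.List using (List; []; _∷_; _++_; length; filter; map; allFin)
open import Data.List.Properties using (filter-≐; filter-none; filter-++; length-++; map-tabulate; map-cong)
open import Data.List.Relation.Unary.All using (universal)
open import Data.Nat using (ℕ; zero; suc; _+_; _*_; _<_; _%_; s≤s; z≤n; s<s⁻¹)
open import Data.Nat.DivMod using (n%n≡0; m<n⇒m%n≡m)
open import Data.Nat.ListAction using (sum)
import Data.Nat.Properties as ℕ
open import Algebra.Properties.CommutativeSemigroup ℕ.+-commutativeSemigroup using (interchange)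
open import Data.Product using (∃; _×_; _,_; proj₁; proj₂)
import Data.Product as Product
open import Data.Product.Function.NonDependent.Propositional using (_×-⇔_)
open import Data.Sum using (_⊎_; inj₁; inj₂)
open import Data.Vec using (Vec; []; _∷_; lookup; init; last)
open import Data.Vec.Properties using (∷-injectiveˡ; ∷-injectiveʳ; lookup-allFin)
open import Function using (id; _∘_; _∘₂_)
open import Function.Bundles using (_⇔_; mk⇔; Equivalence)
import Function.Properties.Equivalence as ⇔
open import Level using (0ℓ)
open import Relation.Binary.PropositionalEquality
  using (_≡_; _≢_; refl; sym; trans; cong; cong₂; subst; module ≡-Reasoning)
open import Relation.Nullary using (Dec; yes; no; does; ¬_; contradiction; _×-dec_)
open import Relation.Nullary.Decidable using (⌊_⌋; ⌊⌋-map′; isYes≗does; does-⇔; toWitness)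
open import Relation.Unary using (Pred; Decidable)
open import Relation.Unary.Properties using (_∪?_)

open Equivalence using (to; from)

count : {A : Set} {P : Pred A 0ℓ} → Decidable P → List A → ℕ
count P? xs = length (filter P? xs)

module _ {A : Set} where

  module _ {P : Pred A 0ℓ} (P? : Decidable P) where

    count-none : (∀ x → ¬ P x) → ∀ xs → count P? xs ≡ 0
    count-none ¬P xs = cong length (filter-none P? (universal ¬P xs))

    count-++ : ∀ xs ys → count P? (xs ++ ys) ≡ count P? xs + count P? ys
    count-++ xs ys = trans (cong length (filter-++ P? xs ys)) (length-++ (filter P? xs))

    count-map : {B : Set} (f : B → A) (xs : List B) → count P? (map f xs) ≡ count (λ x → P? (f x)) xs
    count-map f [] = refl
    count-map f (x ∷ xs) with does (P? (f x))
    ... | true  = cong suc (count-map f xs)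
    ... | false = count-map f xs

  module _ {P Q : Pred A 0ℓ} (P? : Decidable P) (Q? : Decidable Q) where

    count-⇔ : (∀ x → P x ⇔ Q x) → ∀ xs → count P? xs ≡ count Q? xs
    count-⇔ P⇔Q xs = cong length (filter-≐ P? Q? ((λ {x} → to (P⇔Q x)) , (λ {x} → from (P⇔Q x))) xs)

    count-∪ : (∀ x → P x → ¬ Q x) → ∀ xs → count (P? ∪? Q?) xs ≡ count P? xs + count Q? xs
    count-∪ disjoint [] = refl
    count-∪ disjoint (x ∷ xs) with P? x | Q? x
    ... | yes p | yes q = contradiction q (disjoint x p)
    ... | yes _ | no _  = cong suc (count-∪ disjoint xs)
    ... | no _  | yes _ = trans (cong suc (count-∪ disjoint xs)) (sym (ℕ.+-suc _ _))
    ... | no _  | no _  = count-∪ disjoint xs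

count-subsets-suc : ∀ k {P : Pred (Vec Bool (suc k)) 0ℓ} (P? : Decidable P) →
  count P? (subsets (suc k)) ≡ count (λ S → P? (true ∷ S)) (subsets k) + count (λ S → P? (false ∷ S)) (subsets k)
count-subsets-suc k P? = trans (count-++ P? (map (true ∷_) (subsets k)) _)
  (cong₂ _+_ (count-map P? (true ∷_) (subsets k)) (count-map P? (false ∷_) (subsets k)))

AtMostOne : {A : Set} → Pred A 0ℓ → Set
AtMostOne P = ∀ {x x′} → P x → P x′ → x ≡ x′

count-subsets-≡1 : ∀ k {P : Pred (Vec Bool k) 0ℓ} (P? : Decidable P) →
  AtMostOne P → ∀ {S} → P S → count P? (subsets k) ≡ 1
count-subsets-≡1 zero P? _ {[]} p with P? []
... | yes _ = refl
... | no ¬p = contradiction p ¬p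
count-subsets-≡1 (suc k) P? unique {b ∷ S} p = begin
  count P? (subsets (suc k))
    ≡⟨ count-subsets-suc k P? ⟩
  count (λ S → P? (true ∷ S)) (subsets k) + count (λ S → P? (false ∷ S)) (subsets k)
    ≡⟨ cong₂ _+_ (branch true) (branch false) ⟩
  χ ⌊ true Bool.≟ b ⌋ + χ ⌊ false Bool.≟ b ⌋
    ≡⟨ one-branch b ⟩
  1 ∎
  where
  open ≡-Reasoning
  branch : ∀ c → count (λ S → P? (c ∷ S)) (subsets k) ≡ χ ⌊ c Bool.≟ b ⌋
  branch c with c Bool.≟ b
  ... | yes refl = count-subsets-≡1 k (λ S → P? (c ∷ S)) (∷-injectiveʳ ∘₂ unique) p
  ... | no c≢b   = count-none (λ S → P? (c ∷ S)) (λ _ q → c≢b (∷-injectiveˡ (unique q p))) (subsets k)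
  one-branch : ∀ b → χ ⌊ true Bool.≟ b ⌋ + χ ⌊ false Bool.≟ b ⌋ ≡ 1
  one-branch true  = refl
  one-branch false = refl

count-subsets-≡χ : ∀ k {P : Pred (Vec Bool k) 0ℓ} (P? : Decidable P) → AtMostOne P →
  {Q : Set} (Q? : Dec Q) → (∃ P ⇔ Q) → count P? (subsets k) ≡ χ ⌊ Q? ⌋
count-subsets-≡χ k P? unique (yes q) ∃P⇔Q = count-subsets-≡1 k P? unique (proj₂ (from ∃P⇔Q q))
count-subsets-≡χ k P? unique (no ¬q) ∃P⇔Q = count-none P? (λ S p → ¬q (to ∃P⇔Q (S , p))) (subsets k)

χ-injective : ∀ {a b} → χ a ≡ χ b → a ≡ b
χ-injective {true}  {true}  _ = refl
χ-injective {false} {false} _ = refl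

χ-×-dec : {A B : Set} (a? : Dec A) (b? : Dec B) → χ ⌊ a? ×-dec b? ⌋ ≡ χ ⌊ a? ⌋ * χ ⌊ b? ⌋
χ-×-dec (yes _) (yes _) = refl
χ-×-dec (yes _) (no _)  = refl
χ-×-dec (no _)  _       = refl

⌊⌋-⇔ : {A B : Set} → A ⇔ B → (a? : Dec A) (b? : Dec B) → ⌊ a? ⌋ ≡ ⌊ b? ⌋
⌊⌋-⇔ A⇔B a? b? = trans (isYes≗does a?) (trans (does-⇔ A⇔B a? b?) (sym (isYes≗does b?)))

-- Not definitional: ⌊_⌋ matches on its argument, and ℕ._≟_ is built with map′.
⌊suc≟suc⌋ : ∀ a b → ⌊ suc a ℕ.≟ suc b ⌋ ≡ ⌊ a ℕ.≟ b ⌋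
⌊suc≟suc⌋ a b = trans (⌊⌋-map′ _ _ _) (sym (⌊⌋-map′ _ _ _))

χ-∧-∨ : ∀ x {a b} → (T a → T b → ⊥) → χ (x ∧ (a ∨ b)) ≡ χ (x ∧ a) + χ (x ∧ b)
χ-∧-∨ false                 _        = refl
χ-∧-∨ true  {false}         _        = refl
χ-∧-∨ true  {true}  {false} _        = refl
χ-∧-∨ true  {true}  {true}  disjoint = ⊥-elim (disjoint _ _)

isN≡χ : ∀ a → isN a ≡ χ ⌊ a ≟L n ⌋
isN≡χ y = refl
isN≡χ n = refl

map-allFin-suc : ∀ {B : Set} j (f : Fin (suc j) → B) →
  map f (allFin (suc j)) ≡ f zero ∷ map (f ∘ suc) (allFin j)
map-allFin-suc j f = trans (map-tabulate id f) (cong (f zero ∷_) (sym (map-tabulate id (f ∘ suc))))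

sum-map-+ : ∀ {A : Set} (f g : A → ℕ) xs → sum (map (λ x → f x + g x) xs) ≡ sum (map f xs) + sum (map g xs)
sum-map-+ f g [] = refl
sum-map-+ f g (x ∷ xs) = trans (cong (f x + g x +_) (sum-map-+ f g xs)) (interchange (f x) (g x) _ _)

sum-map-0 : ∀ {A : Set} {f : A → ℕ} → (∀ x → f x ≡ 0) → ∀ xs → sum (map f xs) ≡ 0
sum-map-0 f≡0 [] = refl
sum-map-0 f≡0 (x ∷ xs) = cong₂ _+_ (f≡0 x) (sum-map-0 f≡0 xs)

sum-χ-point : ∀ {j} (S : Vec Bool j) (u : Fin j) →
  sum (map (λ e → χ (lookup S e ∧ ⌊ e Fin.≟ u ⌋)) (allFin j)) ≡ χ (lookup S u)
sum-χ-point {suc j} (s ∷ S) zero = begin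
  sum (map (λ e → χ (lookup (s ∷ S) e ∧ ⌊ e Fin.≟ zero ⌋)) (allFin (suc j)))
    ≡⟨ cong sum (map-allFin-suc j _) ⟩
  χ (s ∧ true) + sum (map (λ e → χ (lookup S e ∧ false)) (allFin j))
    ≡⟨ cong₂ _+_ (cong χ (∧-identityʳ s)) (sum-map-0 (λ e → cong χ (∧-zeroʳ (lookup S e))) (allFin j)) ⟩
  χ s + 0
    ≡⟨ ℕ.+-identityʳ (χ s) ⟩
  χ s ∎
  where open ≡-Reasoning
sum-χ-point {suc j} (s ∷ S) (suc u) = begin
  sum (map (λ e → χ (lookup (s ∷ S) e ∧ ⌊ e Fin.≟ suc u ⌋)) (allFin (suc j)))
    ≡⟨ cong sum (map-allFin-suc j _) ⟩
  χ (s ∧ false) + sum (map (λ e → χ (lookup S e ∧ ⌊ suc e Fin.≟ suc u ⌋)) (allFin j))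
    ≡⟨ cong₂ _+_ (cong χ (∧-zeroʳ s)) (cong sum (map-cong (λ e → cong (λ b → χ (lookup S e ∧ b)) (⌊⌋-map′ _ _ (e Fin.≟ u))) (allFin j))) ⟩
  sum (map (λ e → χ (lookup S e ∧ ⌊ e Fin.≟ u ⌋)) (allFin j))
    ≡⟨ sum-χ-point S u ⟩
  χ (lookup S u) ∎
  where open ≡-Reasoning

-- Domino tilings of a word

-- Bit i of S is a domino on positions i, i+1 of w; c is a domino entering
-- position 0 from the left and d one leaving the last position to the right.
Tiling : Bool → {j : ℕ} → Word j → Vec Bool j → Bool → Set
Tiling c []      []      d = c ≡ d
Tiling c (a ∷ w) (s ∷ S) d = χ c + χ s ≡ isN a × Tiling s w S d

tiling? : ∀ c {j} (w : Word j) (S : Vec Bool j) d → Dec (Tiling c w S d)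
tiling? c []      []      d = c Bool.≟ d
tiling? c (a ∷ w) (s ∷ S) d = (χ c + χ s ℕ.≟ isN a) ×-dec tiling? s w S d

tiling-unique : ∀ {c j} {w : Word j} {S S′ d d′} → Tiling c w S d → Tiling c w S′ d′ → S ≡ S′
tiling-unique {w = []}    {[]}    {[]}      _       _         = refl
tiling-unique {c} {w = a ∷ w} {s ∷ S} {s′ ∷ S′} (e , t) (e′ , t′)
  with refl ← χ-injective {s} {s′} (ℕ.+-cancelˡ-≡ (χ c) _ _ (trans e (sym e′)))
  = cong (s ∷_) (tiling-unique t t′)

CoversExactly : Bool → {j : ℕ} → Word j → Vec Bool j → Set
CoversExactly c {j} w S = (i : Fin j) → χ (lookup (c ∷ S) (inject₁ i)) + χ (lookup S i) ≡ isN (lookup w i)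

tiling⇔ : ∀ {c j} {w : Word j} {S d} → Tiling c w S d ⇔ (CoversExactly c w S × last (c ∷ S) ≡ d)
tiling⇔ = mk⇔ (λ t → covered t , outgoing t) (λ (cov , l) → tiling cov l)
  where
  covered : ∀ {c j} {w : Word j} {S d} → Tiling c w S d → CoversExactly c w S
  covered {w = a ∷ w} {s ∷ S} (e , t) zero    = e
  covered {w = a ∷ w} {s ∷ S} (e , t) (suc i) = covered t i
  outgoing : ∀ {c j} {w : Word j} {S d} → Tiling c w S d → last (c ∷ S) ≡ d
  outgoing {w = []}    {[]}    t       = t
  outgoing {w = a ∷ w} {s ∷ S} (_ , t) = outgoing t
  tiling : ∀ {c j} {w : Word j} {S d} → CoversExactly c w S → last (c ∷ S) ≡ d → Tiling c w S d
  tiling {w = []}    {[]}    _   l = l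
  tiling {w = a ∷ w} {s ∷ S} cov l = cov zero , tiling (cov ∘ suc) l

∃tiling-true-start⇔ : ∀ {j} a (w : Word j) d →
  (∃ λ M → Tiling true (a ∷ w) M d) ⇔ (a ≡ n × ∃ λ S → Tiling false w S d)
∃tiling-true-start⇔ a w d = mk⇔ (start a) λ { (refl , S , t) → false ∷ S , refl , t }
  where
  start : ∀ a → (∃ λ M → Tiling true (a ∷ w) M d) → a ≡ n × ∃ λ S → Tiling false w S d
  start n (false ∷ S , refl , t) = refl , S , t
  start n (true  ∷ S , ()   , t)
  start y (_     ∷ S , ()   , t)

∃tiling-true-end⇔ : ∀ {j} c (w : Word (suc j)) →
  (∃ λ S → Tiling c w S true) ⇔ (last w ≡ n × ∃ λ S → Tiling c (init w) S false)
∃tiling-true-end⇔ {zero} c (a ∷ []) = mk⇔ (end c a) λ { (refl , [] , refl) → true ∷ [] , refl , refl }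
  where
  end : ∀ c a → (∃ λ S → Tiling c (a ∷ []) S true) → a ≡ n × ∃ λ S → Tiling c [] S false
  end false n (true ∷ [] , refl , refl) = refl , [] , refl
  end false y (true ∷ [] , ()   , refl)
  end true  n (true ∷ [] , ()   , refl)
  end true  y (true ∷ [] , ()   , refl)
∃tiling-true-end⇔ {suc j} c (a ∷ w) = mk⇔
  (λ { (s ∷ S , e , t) → let (l , S′ , t′) = to (∃tiling-true-end⇔ s w) (S , t) in l , s ∷ S′ , e , t′ })
  (λ { (l , s ∷ S′ , e , t′) → let (S , t) = from (∃tiling-true-end⇔ s w) (l , S′ , t′) in s ∷ S , e , t })

covers-∷-zero : ∀ {k} s (S : Vec Bool k) → covers (s ∷ S) zero ≡ χ s
covers-∷-zero {k} s S = begin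
  covers (s ∷ S) zero
    ≡⟨ cong sum (map-allFin-suc k _) ⟩
  χ (s ∧ true) + sum (map (λ p → χ (lookup S p ∧ false)) (allFin k))
    ≡⟨ cong₂ _+_ (cong χ (∧-identityʳ s)) (sum-map-0 (λ p → cong χ (∧-zeroʳ (lookup S p))) (allFin k)) ⟩
  χ s + 0
    ≡⟨ ℕ.+-identityʳ (χ s) ⟩
  χ s ∎
  where open ≡-Reasoning

covers-∷-suc : ∀ {k} s (S : Vec Bool k) i → covers (s ∷ S) (suc i) ≡ χ (s ∧ ⌊ 0 ℕ.≟ toℕ i ⌋) + covers S i
covers-∷-suc {k} s S i = trans (cong sum (map-allFin-suc k _)) (cong₂ _+_
  (cong (λ b → χ (s ∧ b)) (⌊suc≟suc⌋ 0 (toℕ i)))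
  (cong sum (map-cong (λ p → cong₂ (λ b b′ → χ (lookup S p ∧ (b ∨ b′)))
    (⌊suc≟suc⌋ (toℕ p) (toℕ i)) (⌊suc≟suc⌋ (suc (toℕ p)) (toℕ i))) (allFin k))))

covers≡ : ∀ {k} (S : Vec Bool k) i → covers S i ≡ χ (lookup (false ∷ S) (inject₁ i)) + χ (lookup S i)
covers≡ (s ∷ S)      zero          = covers-∷-zero s S
covers≡ (s ∷ s′ ∷ S) (suc zero)    = trans (covers-∷-suc s (s′ ∷ S) zero)
  (cong₂ _+_ (cong χ (∧-identityʳ s)) (covers-∷-zero s′ S))
covers≡ (s ∷ s′ ∷ S) (suc (suc i)) = trans (covers-∷-suc s (s′ ∷ S) (suc i))
  (cong₂ _+_ (cong χ (∧-zeroʳ s)) (covers≡ (s′ ∷ S) (suc i)))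

pairs-inside⇔ : ∀ {k} (S : Vec Bool k) →
  ((p : Fin k) → lookup S p ≡ true → suc (toℕ p) < k) ⇔ last (false ∷ S) ≡ false
pairs-inside⇔ S = mk⇔ (inside→ S) (inside← S)
  where
  inside→ : ∀ {k} (S : Vec Bool k) → ((p : Fin k) → lookup S p ≡ true → suc (toℕ p) < k) → last (false ∷ S) ≡ false
  inside→ []           _      = refl
  inside→ (true ∷ [])  inside = contradiction (inside zero refl) λ { (s≤s ()) }
  inside→ (false ∷ []) _      = refl
  inside→ (s ∷ s′ ∷ S) inside = inside→ (s′ ∷ S) (λ p e → s<s⁻¹ (inside (suc p) e))
  inside← : ∀ {k} (S : Vec Bool k) → last (false ∷ S) ≡ false → (p : Fin k) → lookup S p ≡ true → suc (toℕ p) < k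
  inside← (false ∷ [])  _ zero    ()
  inside← (s ∷ s′ ∷ S)  _ zero    _ = s≤s (s≤s z≤n)
  inside← (s ∷ s′ ∷ S)  l (suc p) e = s≤s (inside← (s′ ∷ S) l p e)

pairPartition⇔tiling : ∀ {k} {w : Word k} {S} → PairPartition w S ⇔ Tiling false w S false
pairPartition⇔tiling {S = S} = mk⇔
  (λ (inside , cov) → from tiling⇔ ((λ i → trans (sym (covers≡ S i)) (cov i)) , to (pairs-inside⇔ S) inside))
  (λ t → let (cov , l) = to tiling⇔ t in from (pairs-inside⇔ S) l , λ i → trans (covers≡ S i) (cov i))

isFibonacci⇔ : ∀ {k} {w : Word k} → IsFibonacci w ⇔ ∃ λ S → Tiling false w S false
isFibonacci⇔ = mk⇔ (Product.map₂ (to pairPartition⇔tiling)) (Product.map₂ (from pairPartition⇔tiling))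

count-tilings-false : ∀ {k} (w : Word k) → count (λ S → tiling? false w S false) (subsets k) ≡ fibSum k w
count-tilings-false {k} w = count-subsets-≡χ k _ tiling-unique (isFibonacci? w) (⇔.sym isFibonacci⇔)

count-tilings-true : ∀ {k} a (w : Word (suc k)) →
  count (λ M → tiling? true (a ∷ w) M true) (subsets (suc (suc k))) ≡ (n⊗ fibSum k ⊗n) (a ∷ w)
count-tilings-true {k} a w = begin
  count (λ M → tiling? true (a ∷ w) M true) (subsets (suc (suc k)))
    ≡⟨ count-subsets-≡χ _ _ tiling-unique (a ≟L n ×-dec (last w ≟L n ×-dec isFibonacci? (init w))) ends-with-n ⟩
  χ ⌊ a ≟L n ×-dec (last w ≟L n ×-dec isFibonacci? (init w)) ⌋
    ≡⟨ trans (χ-×-dec (a ≟L n) _) (cong (χ ⌊ a ≟L n ⌋ *_) (χ-×-dec (last w ≟L n) _)) ⟩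
  χ ⌊ a ≟L n ⌋ * (χ ⌊ last w ≟L n ⌋ * fibSum k (init w))
    ≡⟨ sym (cong₂ (λ x x′ → x * (x′ * fibSum k (init w))) (isN≡χ a) (isN≡χ (last w))) ⟩
  isN a * (isN (last w) * fibSum k (init w)) ∎
  where
  open ≡-Reasoning
  ends-with-n : (∃ λ M → Tiling true (a ∷ w) M true) ⇔ (a ≡ n × last w ≡ n × IsFibonacci (init w))
  ends-with-n = ⇔.trans (∃tiling-true-start⇔ a w true)
    (⇔.refl ×-⇔ ⇔.trans (∃tiling-true-end⇔ false w) (⇔.refl ×-⇔ ⇔.sym isFibonacci⇔))

-- Cyclic tilings

cycPred : ∀ {j} → Fin (suc j) → Fin (suc j)
cycPred zero    = fromℕ _
cycPred (suc i) = inject₁ i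

last≡lookup-fromℕ : ∀ {j} (M : Vec Bool (suc j)) → last M ≡ lookup M (fromℕ j)
last≡lookup-fromℕ (s ∷ [])     = refl
last≡lookup-fromℕ (s ∷ s′ ∷ M) = last≡lookup-fromℕ (s′ ∷ M)

lookup-last∷-inject₁ : ∀ {j} (M : Vec Bool (suc j)) v → lookup (last M ∷ M) (inject₁ v) ≡ lookup M (cycPred v)
lookup-last∷-inject₁ M zero    = last≡lookup-fromℕ M
lookup-last∷-inject₁ M (suc i) = refl

CyclicCover : ∀ {j} → Word (suc j) → Vec Bool (suc j) → Set
CyclicCover w M = ∀ v → χ (lookup M (cycPred v)) + χ (lookup M v) ≡ isN (lookup w v)

cyclicCover⇔tilings : ∀ {j} {w : Word (suc j)} {M} →
  CyclicCover w M ⇔ (Tiling false w M false ⊎ Tiling true w M true)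
cyclicCover⇔tilings {M = M@(_ ∷ _)} = mk⇔
  (λ cyc → split (last M) (from tiling⇔ ((λ i → trans (wrap i) (cyc i)) , refl)))
  λ { (inj₁ t) → cyclic t ; (inj₂ t) → cyclic t }
  where
  wrap : ∀ i → χ (lookup (last M ∷ M) (inject₁ i)) + χ (lookup M i) ≡ χ (lookup M (cycPred i)) + χ (lookup M i)
  wrap i = cong (λ b → χ b + χ (lookup M i)) (lookup-last∷-inject₁ M i)
  split : ∀ {w} b → Tiling b w M b → Tiling false w M false ⊎ Tiling true w M true
  split false = inj₁
  split true  = inj₂
  cyclic : ∀ {w b} → Tiling b w M b → CyclicCover w M
  cyclic t with to tiling⇔ t
  ... | cov , refl = λ i → trans (sym (wrap i)) (cov i)

tilings-disjoint : ∀ {j} {w : Word (suc j)} M → Tiling false w M false → ¬ Tiling true w M true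
tilings-disjoint (_ ∷ _) t t′ = contradiction (trans (sym (proj₂ (to tiling⇔ t))) (proj₂ (to tiling⇔ t′))) λ ()

-- Perfect matchings of polygons

cycSucc : ∀ {j} → Fin (suc j) → Fin (suc j)
cycSucc {j} e = proj₂ (ends (polygon (suc j)) e)

cycSucc-fromℕ : ∀ j → cycSucc (fromℕ j) ≡ zero
cycSucc-fromℕ j = toℕ-injective (begin
  toℕ (cycSucc (fromℕ j))      ≡⟨ toℕ-fromℕ< _ ⟩
  suc (toℕ (fromℕ j)) % suc j  ≡⟨ cong (λ x → suc x % suc j) (toℕ-fromℕ j) ⟩
  suc j % suc j                ≡⟨ n%n≡0 (suc j) ⟩
  0                            ∎)
  where open ≡-Reasoning

cycSucc-inject₁ : ∀ {j} (i : Fin j) → cycSucc (inject₁ i) ≡ suc i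
cycSucc-inject₁ {j} i = toℕ-injective (begin
  toℕ (cycSucc (inject₁ i))      ≡⟨ toℕ-fromℕ< _ ⟩
  suc (toℕ (inject₁ i)) % suc j  ≡⟨ cong (λ x → suc x % suc j) (toℕ-inject₁ i) ⟩
  suc (toℕ i) % suc j            ≡⟨ m<n⇒m%n≡m (s≤s (toℕ<n i)) ⟩
  suc (toℕ i)                    ∎)
  where open ≡-Reasoning

cycSucc-cycPred : ∀ {j} (v : Fin (suc j)) → cycSucc (cycPred v) ≡ v
cycSucc-cycPred zero    = cycSucc-fromℕ _
cycSucc-cycPred (suc i) = cycSucc-inject₁ i

cycPred-cycSucc : ∀ {j} (e : Fin (suc j)) → cycPred (cycSucc e) ≡ e
cycPred-cycSucc e with view e
... | ‵fromℕ     = cong cycPred (cycSucc-fromℕ _)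
... | ‵inject₁ i = cong cycPred (cycSucc-inject₁ i)

cycSucc≡⇔ : ∀ {j} (e v : Fin (suc j)) → cycSucc e ≡ v ⇔ e ≡ cycPred v
cycSucc≡⇔ e v = mk⇔ (λ { refl → sym (cycPred-cycSucc e) }) (λ { refl → cycSucc-cycPred v })

cycPred≢ : ∀ {k} (v : Fin (suc (suc k))) → cycPred v ≢ v
cycPred≢ zero    ()
cycPred≢ (suc i) eq = ℕ.1+n≢n (trans (sym (cong toℕ eq)) (toℕ-inject₁ i))

degree-polygon : ∀ {k} (M : Vec Bool (suc (suc k))) v →
  degree (polygon (suc (suc k))) M v ≡ χ (lookup M (cycPred v)) + χ (lookup M v)
degree-polygon {k} M v = begin
  degree (polygon (suc (suc k))) M v
    ≡⟨ cong sum (map-cong split (allFin _)) ⟩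
  sum (map (λ e → χ (lookup M e ∧ ⌊ e Fin.≟ v ⌋) + χ (lookup M e ∧ ⌊ e Fin.≟ cycPred v ⌋)) (allFin _))
    ≡⟨ sum-map-+ (λ e → χ (lookup M e ∧ ⌊ e Fin.≟ v ⌋)) (λ e → χ (lookup M e ∧ ⌊ e Fin.≟ cycPred v ⌋)) (allFin _) ⟩
  sum (map (λ e → χ (lookup M e ∧ ⌊ e Fin.≟ v ⌋)) (allFin _))
    + sum (map (λ e → χ (lookup M e ∧ ⌊ e Fin.≟ cycPred v ⌋)) (allFin _))
    ≡⟨ cong₂ _+_ (sum-χ-point M v) (sum-χ-point M (cycPred v)) ⟩
  χ (lookup M v) + χ (lookup M (cycPred v))
    ≡⟨ ℕ.+-comm (χ (lookup M v)) _ ⟩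
  χ (lookup M (cycPred v)) + χ (lookup M v) ∎
  where
  open ≡-Reasoning
  split : ∀ e → χ (lookup M e ∧ (⌊ e Fin.≟ v ⌋ ∨ ⌊ cycSucc e Fin.≟ v ⌋))
              ≡ χ (lookup M e ∧ ⌊ e Fin.≟ v ⌋) + χ (lookup M e ∧ ⌊ e Fin.≟ cycPred v ⌋)
  split e = trans (cong (λ b → χ (lookup M e ∧ (⌊ e Fin.≟ v ⌋ ∨ b))) (⌊⌋-⇔ (cycSucc≡⇔ e v) _ _))
    (χ-∧-∨ (lookup M e) (λ e≡v e≡pv → cycPred≢ v (trans (sym (toWitness e≡pv)) (toWitness e≡v))))

deletedIn-y : ∀ G {k} (xs : Vec (Fin (V G)) k) (ε : Word k) i → lookup ε i ≡ y → deletedIn G xs ε (lookup xs i) ≡ true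
deletedIn-y G (x ∷ xs) (e ∷ ε) zero refl with x Fin.≟ x
... | yes _   = refl
... | no x≢x  = contradiction refl x≢x
deletedIn-y G (x ∷ xs) (e ∷ ε) (suc i) εi≡y = trans (cong (_ ∨_) (deletedIn-y G xs ε i εi≡y)) (∨-zeroʳ _)

deletedIn-n : ∀ G {k} (xs : Vec (Fin (V G)) k) (ε : Word k) v →
  (∀ i → lookup xs i ≡ v → lookup ε i ≡ n) → deletedIn G xs ε v ≡ false
deletedIn-n G []       []      v _      = refl
deletedIn-n G (x ∷ xs) (e ∷ ε) v only-n = cong₂ _∨_ (here (x Fin.≟ v)) (deletedIn-n G xs ε v (only-n ∘ suc))
  where
  here : (x≟v : Dec (x ≡ v)) → ⌊ x≟v ⌋ ∧ ⌊ e ≟L y ⌋ ≡ false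
  here (no _)    = refl
  here (yes x≡v) = cong (λ l → ⌊ l ≟L y ⌋) (only-n zero x≡v)

notDeleted⇔n : ∀ {j} (ε : Word (suc j)) v →
  deletedIn (polygon (suc j)) (polygonVertices (suc j)) ε v ≡ false ⇔ lookup ε v ≡ n
notDeleted⇔n {j} ε v = mk⇔ notDeleted⇒n
  λ εv≡n → deletedIn-n G (polygonVertices (suc j)) ε v (λ i i≡v → trans (cong (lookup ε) (trans (sym (lookup-allFin i)) i≡v)) εv≡n)
  where
  G : Multigraph
  G = polygon (suc j)
  notDeleted⇒n : deletedIn G (polygonVertices (suc j)) ε v ≡ false → lookup ε v ≡ n
  notDeleted⇒n notDeleted with lookup ε v in εv
  ... | n = refl
  ... | y = contradiction (trans (sym deleted) notDeleted) λ ()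
    where
    deleted : deletedIn G (polygonVertices (suc j)) ε v ≡ true
    deleted = subst (λ u → deletedIn G (polygonVertices (suc j)) ε u ≡ true) (lookup-allFin v)
      (deletedIn-y G (polygonVertices (suc j)) ε v εv)

covered⇒n : ∀ {a b l} → χ a + χ b ≡ isN l → a ≡ true ⊎ b ≡ true → l ≡ n
covered⇒n {l = n}                 _  _         = refl
covered⇒n {true}          {l = y} () _
covered⇒n {false} {true}  {y}     () _
covered⇒n {false} {false} {y}     _  (inj₁ ())
covered⇒n {false} {false} {y}     _  (inj₂ ())

perfectMatching⇔ : ∀ {k} (ε : Word (suc (suc k))) M →
  IsPerfectMatching (polygon (suc (suc k))) (deletedIn (polygon (suc (suc k))) (polygonVertices (suc (suc k))) ε) M
    ⇔ CyclicCover ε M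
perfectMatching⇔ {k} ε M = mk⇔ cover matching
  where
  G : Multigraph
  G = polygon (suc (suc k))
  del : Fin (suc (suc k)) → Bool
  del = deletedIn G (polygonVertices (suc (suc k))) ε
  unmatched : ∀ e → ¬ lookup M e ≡ true → χ (lookup M e) ≡ 0
  unmatched e ¬m with lookup M e
  ... | true  = contradiction refl ¬m
  ... | false = refl
  cover : IsPerfectMatching G del M → CyclicCover ε M
  cover (endsKept , deg) v with lookup ε v in εv
  ... | n = trans (sym (degree-polygon M v)) (deg v (from (notDeleted⇔n ε v) εv))
  ... | y = cong₂ _+_
    (unmatched (cycPred v) λ m → notKept (subst (λ u → del u ≡ false) (cycSucc-cycPred v) (proj₂ (endsKept (cycPred v) m))))
    (unmatched v λ m → notKept (proj₁ (endsKept v m)))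
    where
    notKept : ¬ del v ≡ false
    notKept kept = contradiction (trans (sym εv) (to (notDeleted⇔n ε v) kept)) λ ()
  matching : CyclicCover ε M → IsPerfectMatching G del M
  matching cyc =
    (λ e m → from (notDeleted⇔n ε e) (covered⇒n (cyc e) (inj₂ m))
           , from (notDeleted⇔n ε (cycSucc e))
                  (covered⇒n (cyc (cycSucc e)) (inj₁ (trans (cong (lookup M) (cycPred-cycSucc e)) m))))
    , λ v kept → trans (degree-polygon M v) (trans (cyc v) (cong isN (to (notDeleted⇔n ε v) kept)))

stateSum-polygon : ∀ {k} (ε : Word (suc (suc k))) →
  stateSum (polygon (suc (suc k))) (polygonVertices (suc (suc k))) ε
    ≡ count (λ M → tiling? false ε M false) (subsets (suc (suc k)))
      + count (λ M → tiling? true ε M true) (subsets (suc (suc k)))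
stateSum-polygon {k} ε = trans
  (count-⇔ (isPerfectMatching? _ _) ((λ M → tiling? false ε M false) ∪? (λ M → tiling? true ε M true))
    (λ M → ⇔.trans (perfectMatching⇔ ε M) cyclicCover⇔tilings) (subsets (suc (suc k))))
  (count-∪ (λ M → tiling? false ε M false) (λ M → tiling? true ε M true) tilings-disjoint (subsets (suc (suc k))))

lemma5 : (k : ℕ) (ε : Word (suc (suc k))) →
    stateSum (polygon (suc (suc k))) (polygonVertices (suc (suc k))) ε
      ≡ (fibSum (suc (suc k)) ⊕ (n⊗ fibSum k ⊗n)) ε
lemma5 k (a ∷ w) = trans (stateSum-polygon (a ∷ w))
  (cong₂ _+_ (count-tilings-false (a ∷ w)) (count-tilings-true a w))
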